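{- Let $G$ be any graph, let $n \geq 2$, and consider the $n$-cone $\overline{K}_n \vee G$. Let $c_j \coloneqq \max \{j, n + 1 - j + \sigma_{j - \alpha(G)}(G)\}$. \begin{enumerate} \item If $n \geq |V_G|$ then $\sigma(\overline{K}_n \vee G)=\min\limits_{1 \leq j \leq |V_G|} c_j$. \item If $\alpha(G) < n <|V_G|$ then $\sigma(\overline{K}_n \vee G)=\min \left\{ \min\limits_{1 \leq j \leq n} c_j, \sigma_{n+1 - \alpha(G)}(G) \right\}$. \item If $n \leq \alpha(G)$ then \begin{align*} \sigma(\overline{K}_n \vee G) &= \min \left\{ \min\limits_{1 \leq j \leq n} \max \{j, \alpha(G)+1-j\}, \,\sigma(G)\right\} \\ &= \begin{cases} \min \left\{\sigma(G), \left\lceil \frac{\alpha(G)+1}{2} \right\rceil\right\} & \text{if $n > \left\lfloor \frac{\alpha(G)+1}{2} \right\rfloor$,} \\ \min \left\{\sigma(G), \alpha(G)+1-n \right\} &\text{if $n \leq \left\lfloor \frac{\alpha(G)+1}{2} \right\rfloor$.} \end{cases} \end{align*} \end{enumerate}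
   Context: All graphs are finite, undirected and simple. $\overline{K}_n$ denotes the empty (edgeless) graph on $n$ vertices, and $\overline{K}_n\vee G$ (the join of $\overline{K}_n$ with $G$: disjoint union plus all edges between them) is called the $n$-cone of $G$. $\alpha(G)$ is the independence number and $\Delta(G)$ the maximum degree. For a nonempty graph $G=(V,E)$, $\sigma(G)=\min\{\Delta(G[S]) : S\subseteq V,\ |S|>\alpha(G)\}$, and $\sigma(\overline{K}_m)=\infty$. For nonempty $G$ and integer $k\le |V_G|-\alpha(G)$, $\sigma_k(G)=0$ if $k\le 0$ and, for $1\le k\le |V_G|-\alpha(G)$, $\sigma_k(G)$ is the minimum of $\Delta(H)$ over induced subgraphs $H$ of $G$ on $\alpha(G)+k$ vertices; for the empty graph, $\sigma_k(\overline{K}_m)=0$ if $k\le0$ and $\infty$ if $1\le k\le m$. -}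

module Defs where

open import Data.Bool using (Bool; true; false; _∧_; not) renaming (_≟_ to _≟ᵇ_)
open import Data.Nat using (ℕ; zero; suc; _+_; _∸_; _⊔_; _⊓_; _<?_; _≟_)
open import Data.Fin using (Fin; splitAt)
open import Data.Fin.Subset using (Subset; _∈_; ∣_∣)
open import Data.Sum using (inj₁; inj₂)
open import Data.List using (List; []; _∷_; map; _++_; foldr; filter; allFin; length)
open import Data.Bool.ListAction using (all)
open import Data.Vec using (_∷_; []; lookup)
open import Relation.Binary.PropositionalEquality using (_≡_; refl)

record Graph : Set where
  field
    V      : ℕ
    adj    : Fin V → Fin V → Bool
    sym    : ∀ i j → adj i j ≡ adj j i
    irrefl : ∀ i → adj i i ≡ false
open Graph public

data ℕ∞ : Set where
  fin : ℕ → ℕ∞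
  ∞   : ℕ∞

infixl 7 _⊓∞_
infixl 6 _⊔∞_

_⊓∞_ : ℕ∞ → ℕ∞ → ℕ∞
fin a ⊓∞ fin b = fin (a ⊓ b)
fin a ⊓∞ ∞     = fin a
∞     ⊓∞ y     = y

_⊔∞_ : ℕ∞ → ℕ∞ → ℕ∞
fin a ⊔∞ fin b = fin (a ⊔ b)
fin a ⊔∞ ∞     = ∞
∞     ⊔∞ y     = ∞

_+∞_ : ℕ → ℕ∞ → ℕ∞
a +∞ fin b = fin (a + b)
a +∞ ∞     = ∞

min∞ : List ℕ∞ → ℕ∞
min∞ = foldr _⊓∞_ ∞

maxℕ : List ℕ → ℕ
maxℕ = foldr _⊔_ 0

min1to : ℕ → (ℕ → ℕ∞) → ℕ∞
min1to zero    f = ∞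
min1to (suc m) f = min1to m f ⊓∞ f (suc m)

allSubsets : (n : ℕ) → List (Subset n)
allSubsets zero    = [] ∷ []
allSubsets (suc n) = map (true ∷_) (allSubsets n) ++ map (false ∷_) (allSubsets n)

module _ (G : Graph) where

  independent : Subset (V G) → Bool
  independent S = all (λ i → all (λ j → not (lookup S i ∧ lookup S j ∧ adj G i j)) (allFin (V G))) (allFin (V G))

  α : ℕ
  α = maxℕ (map ∣_∣ (filter (λ S → independent S ≟ᵇ true) (allSubsets (V G))))

  degIn : Subset (V G) → Fin (V G) → ℕ
  degIn S v = length (filter (λ u → (lookup S u ∧ adj G v u) ≟ᵇ true) (allFin (V G)))

  Δ[_] : Subset (V G) → ℕ
  Δ[ S ] = maxℕ (map (degIn S) (filter (λ v → lookup S v ≟ᵇ true) (allFin (V G))))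

  -- σ(G) = min { Δ(G[S]) : |S| > α(G) }   (∞ if no such S, i.e. G edgeless)
  σ : ℕ∞
  σ = min∞ (map (λ S → fin Δ[ S ]) (filter (λ S → α <? ∣ S ∣) (allSubsets (V G))))

  -- The index is a natural number; σ_{j - α} is written σₖ G (j ∸ α G), which is
  -- faithful because σ_k = 0 for every k ≤ 0.
  σₖ : ℕ → ℕ∞
  σₖ zero    = fin 0
  σₖ (suc k) = min∞ (map (λ S → fin Δ[ S ]) (filter (λ S → ∣ S ∣ ≟ (α + suc k)) (allSubsets (V G))))

-- n-cone  K̄_n ∨ G : vertices Fin (n + V G); the first n form the empty graph K̄_n

module _ (n : ℕ) (G : Graph) where
  private
    cadj : Fin (n + V G) → Fin (n + V G) → Bool
    cadj x y with splitAt n x | splitAt n y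
    ... | inj₁ _ | inj₁ _ = false
    ... | inj₁ _ | inj₂ _ = true
    ... | inj₂ _ | inj₁ _ = true
    ... | inj₂ a | inj₂ b = adj G a b

    csym : ∀ x y → cadj x y ≡ cadj y x
    csym x y with splitAt n x | splitAt n y
    ... | inj₁ _ | inj₁ _ = refl
    ... | inj₁ _ | inj₂ _ = refl
    ... | inj₂ _ | inj₁ _ = refl
    ... | inj₂ a | inj₂ b = sym G a b

    cirr : ∀ x → cadj x x ≡ false
    cirr x with splitAt n x
    ... | inj₁ _ = refl
    ... | inj₂ a = irrefl G a

  cone : Graph
  cone = record { V = n + V G ; adj = cadj ; sym = csym ; irrefl = cirr }

c : ℕ → Graph → ℕ → ℕ∞
c n G j = fin j ⊔∞ ((n + 1 ∸ j) +∞ σₖ G (j ∸ α G))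

-- Write H for the n-cone and a = α(G). An independent set of H lies entirely in
-- K̄ₙ or entirely in G, so α(H) = max(n, a), and σ(H) is the least Δ(H[A ∪ B]) over
-- A ⊆ K̄ₙ, B ⊆ V_G with |A| + |B| > max(n, a). When A and B are both nonempty,
-- Δ(H[A ∪ B]) = max(|B|, |A| + Δ(G[B])); when A is empty it is Δ(G[B]). Minimising
-- over B of fixed size j and A as small as allowed gives c_j when a ≤ n, and
-- max(j, a + 1 - j) (with B independent) when n ≤ a; the sets with A empty
-- contribute σ_{n+1-a}(G), resp. σ(G).
module Submission where

open import Defs hiding (sym)
open import Data.Bool using (Bool; true; false; _∧_; not; if_then_else_) renaming (_≟_ to _≟ᵇ_)
open import Data.Bool.Properties using (T-≡; ∧-zeroʳ; ∧-identityʳ)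
open import Data.Empty using (⊥-elim)
open import Data.Fin using (Fin; zero; suc; _↑ˡ_; _↑ʳ_; splitAt)
open import Data.Fin.Properties using (splitAt-↑ˡ; splitAt-↑ʳ; splitAt⁻¹-↑ˡ; splitAt⁻¹-↑ʳ)
open import Data.Fin.Subset using (Subset; ∣_∣; ⊥; ⊤)
open import Data.Fin.Subset.Properties using (∣⊥∣≡0; ∣⊤∣≡n; ∣p∣≤n)
open import Data.List using (List; map; filter; allFin; length; tabulate)
open import Data.List.Membership.Propositional using (_∈_)
open import Data.List.Membership.Propositional.Properties
  using (foldr-selective; ∈-map⁺; ∈-++⁺ˡ; ∈-++⁺ʳ; ∈-allFin; ∈-map∘filter⁺; ∈-map∘filter⁻)
open import Data.List.Properties using (foldr-preservesᵇ; foldr-preservesᵒ)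
open import Data.List.Relation.Unary.All as All using (All)
open import Data.List.Relation.Unary.All.Properties using (all⁺; all⁻)
open import Data.Bool.ListAction using (all)
import Data.List.Relation.Unary.Any as Any
open import Data.Nat using (ℕ; zero; suc; _+_; _∸_; _≤_; _<_; _>_; _⊔_; z≤n; s≤s; s≤s⁻¹; z<s; ⌊_/2⌋; ⌈_/2⌉; _≤?_; _<?_)
  renaming (_≟_ to _≟ℕ_)
open import Data.Nat.Properties
open import Data.Product using (_×_; _,_; ∃-syntax)
open import Data.Sum using (_⊎_; inj₁; inj₂; [_,_])
open import Data.Vec using (lookup; _++_) renaming ([] to []ᵛ; _∷_ to _∷ᵛ_)
import Data.Vec as Vec
open import Data.Vec.Properties using (lookup-replicate; lookup-++ˡ; lookup-++ʳ)
open import Function using (_∘_; Equivalence)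
open import Relation.Binary.PropositionalEquality using (_≡_; refl; sym; trans; cong; cong₂; subst; subst₂; module ≡-Reasoning)
open import Relation.Nullary using (yes; no)
open import Relation.Unary using (Decidable)

-- The order on ℕ∞

infix 4 _≤∞_

data _≤∞_ : ℕ∞ → ℕ∞ → Set where
  fin≤fin : ∀ {a b} → a ≤ b → fin a ≤∞ fin b
  x≤∞∞    : ∀ {x} → x ≤∞ ∞

≤∞-refl : ∀ {x} → x ≤∞ x
≤∞-refl {fin x} = fin≤fin ≤-refl
≤∞-refl {∞}     = x≤∞∞

≤∞-reflexive : ∀ {x y} → x ≡ y → x ≤∞ y
≤∞-reflexive refl = ≤∞-refl

≤∞-trans : ∀ {x y z} → x ≤∞ y → y ≤∞ z → x ≤∞ z
≤∞-trans (fin≤fin p) (fin≤fin q) = fin≤fin (≤-trans p q)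
≤∞-trans _           x≤∞∞        = x≤∞∞

≤∞-antisym : ∀ {x y} → x ≤∞ y → y ≤∞ x → x ≡ y
≤∞-antisym (fin≤fin p) (fin≤fin q) = cong fin (≤-antisym p q)
≤∞-antisym x≤∞∞        x≤∞∞        = refl

x⊓∞y≤∞x : ∀ x y → x ⊓∞ y ≤∞ x
x⊓∞y≤∞x (fin a) (fin b) = fin≤fin (m⊓n≤m a b)
x⊓∞y≤∞x (fin a) ∞       = ≤∞-refl
x⊓∞y≤∞x ∞       y       = x≤∞∞

x⊓∞y≤∞y : ∀ x y → x ⊓∞ y ≤∞ y
x⊓∞y≤∞y (fin a) (fin b) = fin≤fin (m⊓n≤n a b)
x⊓∞y≤∞y (fin a) ∞       = x≤∞∞
x⊓∞y≤∞y ∞       y       = ≤∞-refl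

⊓∞-glb : ∀ {z x y} → z ≤∞ x → z ≤∞ y → z ≤∞ x ⊓∞ y
⊓∞-glb (fin≤fin p) (fin≤fin q) = fin≤fin (⊓-glb p q)
⊓∞-glb (fin≤fin p) x≤∞∞        = fin≤fin p
⊓∞-glb x≤∞∞        q           = q

⊓∞-comm : ∀ x y → x ⊓∞ y ≡ y ⊓∞ x
⊓∞-comm (fin a) (fin b) = cong fin (⊓-comm a b)
⊓∞-comm (fin a) ∞       = refl
⊓∞-comm ∞       (fin b) = refl
⊓∞-comm ∞       ∞       = refl

⊓∞-sel : ∀ x y → x ⊓∞ y ≡ x ⊎ x ⊓∞ y ≡ y
⊓∞-sel (fin a) (fin b) with ⊓-sel a b
... | inj₁ a⊓b≡a = inj₁ (cong fin a⊓b≡a)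
... | inj₂ a⊓b≡b = inj₂ (cong fin a⊓b≡b)
⊓∞-sel (fin a) ∞       = inj₁ refl
⊓∞-sel ∞       y       = inj₂ refl

⊔∞-+∞-monoʳ : ∀ j k {s t} → s ≤∞ t → fin j ⊔∞ (k +∞ s) ≤∞ fin j ⊔∞ (k +∞ t)
⊔∞-+∞-monoʳ j k (fin≤fin p) = fin≤fin (⊔-monoʳ-≤ j (+-monoʳ-≤ k p))
⊔∞-+∞-monoʳ j k {fin _} x≤∞∞ = x≤∞∞
⊔∞-+∞-monoʳ j k {∞}     x≤∞∞ = x≤∞∞

min∞-≤∞ : ∀ {x xs} → x ∈ xs → min∞ xs ≤∞ x
min∞-≤∞ {xs = xs} x∈xs =
  foldr-preservesᵒ (λ y z → [ ≤∞-trans (x⊓∞y≤∞x y z) , ≤∞-trans (x⊓∞y≤∞y y z) ]) ∞ xs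
    (inj₂ (Any.map (λ { refl → ≤∞-refl }) x∈xs))

≤∞-min∞ : ∀ {z xs} → All (z ≤∞_) xs → z ≤∞ min∞ xs
≤∞-min∞ = foldr-preservesᵇ ⊓∞-glb x≤∞∞

min∞-selective : ∀ xs → min∞ xs ≡ ∞ ⊎ min∞ xs ∈ xs
min∞-selective = foldr-selective ⊓∞-sel ∞

≤-maxℕ : ∀ {x xs} → x ∈ xs → x ≤ maxℕ xs
≤-maxℕ {xs = xs} x∈xs =
  foldr-preservesᵒ (λ y z → [ m≤n⇒m≤n⊔o z , m≤n⇒m≤o⊔n y ]) 0 xs
    (inj₂ (Any.map (λ { refl → ≤-refl }) x∈xs))

maxℕ-≤ : ∀ {k xs} → All (_≤ k) xs → maxℕ xs ≤ k
maxℕ-≤ = foldr-preservesᵇ ⊔-lub z≤n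

maxℕ-selective : ∀ xs → maxℕ xs ≡ 0 ⊎ maxℕ xs ∈ xs
maxℕ-selective = foldr-selective ⊔-sel 0

module _ {A : Set} {P : A → Set} (P? : Decidable P) {xs : List A} where

  min∞-map-filter-≤∞ : ∀ (f : A → ℕ∞) {x} → x ∈ xs → P x → min∞ (map f (filter P? xs)) ≤∞ f x
  min∞-map-filter-≤∞ f {x} x∈xs px = min∞-≤∞ (∈-map∘filter⁺ f P? (x , x∈xs , refl , px))

  ≤∞-min∞-map-filter : ∀ (f : A → ℕ∞) {z} → (∀ {x} → P x → z ≤∞ f x) → z ≤∞ min∞ (map f (filter P? xs))
  ≤∞-min∞-map-filter f h = ≤∞-min∞ (All.tabulate λ y∈ →
    let _ , _ , y≡fx , px = ∈-map∘filter⁻ f P? {xs = xs} y∈ in subst (_ ≤∞_) (sym y≡fx) (h px))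

  min∞-map-filter-attained : ∀ (f : A → ℕ∞) → let m = min∞ (map f (filter P? xs)) in
                             m ≡ ∞ ⊎ ∃[ x ] P x × f x ≡ m
  min∞-map-filter-attained f with min∞-selective (map f (filter P? xs))
  ... | inj₁ m≡∞ = inj₁ m≡∞
  ... | inj₂ m∈  = let x , _ , m≡fx , px = ∈-map∘filter⁻ f P? {xs = xs} m∈ in inj₂ (x , px , sym m≡fx)

  ≤-maxℕ-map-filter : ∀ (f : A → ℕ) {x} → x ∈ xs → P x → f x ≤ maxℕ (map f (filter P? xs))
  ≤-maxℕ-map-filter f {x} x∈xs px = ≤-maxℕ (∈-map∘filter⁺ f P? (x , x∈xs , refl , px))

  maxℕ-map-filter-≤ : ∀ (f : A → ℕ) {k} → (∀ {x} → P x → f x ≤ k) → maxℕ (map f (filter P? xs)) ≤ k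
  maxℕ-map-filter-≤ f h = maxℕ-≤ (All.tabulate λ y∈ →
    let _ , _ , y≡fx , px = ∈-map∘filter⁻ f P? {xs = xs} y∈ in subst (_≤ _) (sym y≡fx) (h px))

  maxℕ-map-filter-attained : ∀ (f : A → ℕ) → let m = maxℕ (map f (filter P? xs)) in
                             m ≡ 0 ⊎ ∃[ x ] P x × f x ≡ m
  maxℕ-map-filter-attained f with maxℕ-selective (map f (filter P? xs))
  ... | inj₁ m≡0 = inj₁ m≡0
  ... | inj₂ m∈  = let x , _ , m≡fx , px = ∈-map∘filter⁻ f P? {xs = xs} m∈ in inj₂ (x , px , sym m≡fx)

min1to-≤∞ : ∀ {m j} (f : ℕ → ℕ∞) → 1 ≤ j → j ≤ m → min1to m f ≤∞ f j
min1to-≤∞ {zero}  f 1≤j j≤0 = ⊥-elim (<⇒≱ 1≤j j≤0)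
min1to-≤∞ {suc m} {j} f 1≤j j≤1+m with j ≟ℕ suc m
... | yes refl = x⊓∞y≤∞y (min1to m f) (f (suc m))
... | no j≢1+m = ≤∞-trans (x⊓∞y≤∞x (min1to m f) _) (min1to-≤∞ f 1≤j (s≤s⁻¹ (≤∧≢⇒< j≤1+m j≢1+m)))

≤∞-min1to : ∀ {z} m (f : ℕ → ℕ∞) → (∀ {j} → 1 ≤ j → j ≤ m → z ≤∞ f j) → z ≤∞ min1to m f
≤∞-min1to zero    f h = x≤∞∞
≤∞-min1to (suc m) f h = ⊓∞-glb (≤∞-min1to m f (λ 1≤j j≤m → h 1≤j (m≤n⇒m≤1+n j≤m))) (h (s≤s z≤n) ≤-refl)

count : ∀ {N} → (Fin N → Bool) → ℕ
count {zero}  f = 0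
count {suc N} f = (if f zero then 1 else 0) + count (f ∘ suc)

length-filter-tabulate : ∀ {A : Set} {N} (g : Fin N → A) (p : A → Bool) →
  length (filter (λ u → p u ≟ᵇ true) (tabulate g)) ≡ count (p ∘ g)
length-filter-tabulate {N = zero}  g p = refl
length-filter-tabulate {N = suc N} g p with p (g zero)
... | true  = cong suc (length-filter-tabulate (g ∘ suc) p)
... | false = length-filter-tabulate (g ∘ suc) p

∣∣≡count : ∀ {N} (S : Subset N) → ∣ S ∣ ≡ count (lookup S)
∣∣≡count []ᵛ          = refl
∣∣≡count (true ∷ᵛ S)  = cong suc (∣∣≡count S)
∣∣≡count (false ∷ᵛ S) = ∣∣≡count S

∣++∣ : ∀ {m n} (A : Subset m) (B : Subset n) → ∣ A ++ B ∣ ≡ ∣ A ∣ + ∣ B ∣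
∣++∣ []ᵛ          B = refl
∣++∣ (true ∷ᵛ A)  B = cong suc (∣++∣ A B)
∣++∣ (false ∷ᵛ A) B = ∣++∣ A B

count-++ : ∀ m {n} (f : Fin (m + n) → Bool) → count f ≡ count (f ∘ (_↑ˡ n)) + count (f ∘ (m ↑ʳ_))
count-++ zero    f = refl
count-++ (suc m) {n} f = trans (cong (b +_) (count-++ m (f ∘ suc))) (sym (+-assoc b _ _))
  where b = if f zero then 1 else 0

count-mono : ∀ {N} {f g : Fin N → Bool} → (∀ i → f i ≡ true → g i ≡ true) → count f ≤ count g
count-mono {zero}          h = z≤n
count-mono {suc N} {f} {g} h with f zero in fz | g zero in gz
... | true  | true  = s≤s (count-mono (h ∘ suc))
... | false | true  = m≤n⇒m≤1+n (count-mono (h ∘ suc))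
... | false | false = count-mono (h ∘ suc)
... | true  | false with trans (sym gz) (h zero fz)
... | ()

count-cong : ∀ {N} {f g : Fin N → Bool} → (∀ i → f i ≡ g i) → count f ≡ count g
count-cong {zero}  h = refl
count-cong {suc N} h rewrite h zero = cong (_ +_) (count-cong (h ∘ suc))

count-false : ∀ {N} {f : Fin N → Bool} → (∀ i → f i ≡ false) → count f ≡ 0
count-false {zero}  h = refl
count-false {suc N} h rewrite h zero = count-false (h ∘ suc)

count-witness : ∀ {N} (f : Fin N → Bool) → 1 ≤ count f → ∃[ i ] f i ≡ true
count-witness {suc N} f 1≤c with f zero in fz
... | true  = zero , fz
... | false = let i , fi = count-witness (f ∘ suc) 1≤c in suc i , fi

∣∣-witness : ∀ {N} (S : Subset N) → 1 ≤ ∣ S ∣ → ∃[ i ] lookup S i ≡ true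
∣∣-witness S 1≤∣S∣ = count-witness (lookup S) (subst (1 ≤_) (∣∣≡count S) 1≤∣S∣)

∉⊥ : ∀ {N} (i : Fin N) → lookup ⊥ i ≡ false
∉⊥ i = lookup-replicate i false

∈⊥-elim : ∀ {N} {i : Fin N} {B : Set} → lookup ⊥ i ≡ true → B
∈⊥-elim {i = i} i∈⊥ with trans (sym (∉⊥ i)) i∈⊥
... | ()

infix 4 _⊆_

_⊆_ : ∀ {N} → Subset N → Subset N → Set
T ⊆ S = ∀ i → lookup T i ≡ true → lookup S i ≡ true

⊆-ofSize : ∀ {N} (S : Subset N) m → m ≤ ∣ S ∣ → ∃[ T ] T ⊆ S × ∣ T ∣ ≡ m
⊆-ofSize {N} S zero _ = ⊥ , (λ i i∈⊥ → ∈⊥-elim {i = i} i∈⊥) , ∣⊥∣≡0 N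
⊆-ofSize (true ∷ᵛ S) (suc m) (s≤s m≤∣S∣) =
  let T , T⊆S , ∣T∣≡m = ⊆-ofSize S m m≤∣S∣
  in (true ∷ᵛ T) , (λ { zero _ → refl ; (suc i) → T⊆S i }) , cong suc ∣T∣≡m
⊆-ofSize (false ∷ᵛ S) (suc m) m<∣S∣ =
  let T , T⊆S , ∣T∣≡m = ⊆-ofSize S (suc m) m<∣S∣
  in (false ∷ᵛ T) , (λ { zero () ; (suc i) → T⊆S i }) , ∣T∣≡m

subset-ofSize : ∀ {N} k → k ≤ N → ∃[ A ] ∣ A ∣ ≡ k
subset-ofSize {N} k k≤N =
  let A , _ , ∣A∣≡k = ⊆-ofSize (⊤ {N}) k (subst (k ≤_) (sym (∣⊤∣≡n N)) k≤N) in A , ∣A∣≡k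

∈-allSubsets : ∀ {N} (S : Subset N) → S ∈ allSubsets N
∈-allSubsets []ᵛ                  = Any.here refl
∈-allSubsets {suc N} (true ∷ᵛ S)  = ∈-++⁺ˡ (∈-map⁺ (true ∷ᵛ_) (∈-allSubsets S))
∈-allSubsets {suc N} (false ∷ᵛ S) = ∈-++⁺ʳ (map (true ∷ᵛ_) (allSubsets N)) (∈-map⁺ (false ∷ᵛ_) (∈-allSubsets S))

all≡true⁻ : ∀ {A : Set} (p : A → Bool) xs → all p xs ≡ true → ∀ {x} → x ∈ xs → p x ≡ true
all≡true⁻ p xs all≡true x∈xs =
  Equivalence.to T-≡ (All.lookup (all⁺ p xs (Equivalence.from T-≡ all≡true)) x∈xs)

all≡true⁺ : ∀ {A : Set} (p : A → Bool) xs → (∀ {x} → x ∈ xs → p x ≡ true) → all p xs ≡ true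
all≡true⁺ p xs h = Equivalence.to T-≡ (all⁻ p (All.tabulate (Equivalence.from T-≡ ∘ h)))

↑ˡ-or-↑ʳ : ∀ m {n} (v : Fin (m + n)) → (∃[ i ] i ↑ˡ n ≡ v) ⊎ (∃[ j ] m ↑ʳ j ≡ v)
↑ˡ-or-↑ʳ m v with splitAt m v in eq
... | inj₁ i = inj₁ (i , splitAt⁻¹-↑ˡ eq)
... | inj₂ j = inj₂ (j , splitAt⁻¹-↑ʳ eq)

m<k+l∧k≤m⇒0<l : ∀ {m} k l → m < k + l → k ≤ m → 0 < l
m<k+l∧k≤m⇒0<l k zero    m<k+0 k≤m = ⊥-elim (<⇒≱ m<k+0 (subst (_≤ _) (sym (+-identityʳ k)) k≤m))
m<k+l∧k≤m⇒0<l k (suc l) _     _   = z<s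

m<k+l∧l≤m⇒0<k : ∀ {m} k l → m < k + l → l ≤ m → 0 < k
m<k+l∧l≤m⇒0<k {m} k l m<k+l = m<k+l∧k≤m⇒0<l l k (subst (m <_) (+-comm k l) m<k+l)

m∸n≡1+k⇒m≡n+1+k : ∀ {m n k} → m ∸ n ≡ suc k → m ≡ n + suc k
m∸n≡1+k⇒m≡n+1+k {m} {n} m∸n≡1+k =
  trans (sym (m+[n∸m]≡n (<⇒≤ (m∸n≢0⇒n<m {m} {n} λ m∸n≡0 → 0≢1+n (trans (sym m∸n≡0) m∸n≡1+k)))))
        (cong (n +_) m∸n≡1+k)

-- Graph invariants

module Invariants (G : Graph) where

  private
    N = V G

  degIn≡count : ∀ S v → degIn G S v ≡ count (λ u → lookup S u ∧ adj G v u)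
  degIn≡count S v = length-filter-tabulate (λ u → u) (λ u → lookup S u ∧ adj G v u)

  degIn≤Δ : ∀ S {v} → lookup S v ≡ true → degIn G S v ≤ Δ[ G ] S
  degIn≤Δ S {v} = ≤-maxℕ-map-filter (λ v → lookup S v ≟ᵇ true) (degIn G S) (∈-allFin v)

  Δ-lub : ∀ S {k} → (∀ {v} → lookup S v ≡ true → degIn G S v ≤ k) → Δ[ G ] S ≤ k
  Δ-lub S = maxℕ-map-filter-≤ (λ v → lookup S v ≟ᵇ true) {allFin N} (degIn G S)

  Δ-attained : ∀ S {v₀} → lookup S v₀ ≡ true → ∃[ v ] lookup S v ≡ true × degIn G S v ≡ Δ[ G ] S
  Δ-attained S {v₀} v₀∈S with maxℕ-map-filter-attained (λ v → lookup S v ≟ᵇ true) {allFin N} (degIn G S)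
  ... | inj₂ attained = attained
  ... | inj₁ Δ≡0      = v₀ , v₀∈S , ≤-antisym (degIn≤Δ S v₀∈S) (subst (_≤ degIn G S v₀) (sym Δ≡0) z≤n)

  Δ-mono : ∀ T S → T ⊆ S → Δ[ G ] T ≤ Δ[ G ] S
  Δ-mono T S T⊆S = Δ-lub T λ {v} v∈T → begin
    degIn G T v                               ≡⟨ degIn≡count T v ⟩
    count (λ u → lookup T u ∧ adj G v u)      ≤⟨ count-mono (λ u → ∧-monoˡ (T⊆S u)) ⟩
    count (λ u → lookup S u ∧ adj G v u)      ≡⟨ degIn≡count S v ⟨
    degIn G S v                               ≤⟨ degIn≤Δ S (T⊆S v v∈T) ⟩
    Δ[ G ] S                                  ∎
    where
      open ≤-Reasoning
      ∧-monoˡ : ∀ {x y z} → (x ≡ true → y ≡ true) → x ∧ z ≡ true → y ∧ z ≡ true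
      ∧-monoˡ {true} x⇒y x∧z rewrite x⇒y refl = x∧z

  independent⁻ : ∀ S → independent G S ≡ true →
                 ∀ {i j} → lookup S i ≡ true → lookup S j ≡ true → adj G i j ≡ false
  independent⁻ S indep {i} {j} i∈S j∈S
    with all≡true⁻ _ (allFin N) (all≡true⁻ _ (allFin N) indep (∈-allFin i)) (∈-allFin j)
  ... | no-edge rewrite i∈S | j∈S with adj G i j
  ...   | false = refl

  independent⁺ : ∀ S → (∀ {i j} → lookup S i ≡ true → lookup S j ≡ true → adj G i j ≡ false) →
                 independent G S ≡ true
  independent⁺ S no-edge =
    all≡true⁺ _ (allFin N) λ {i} _ → all≡true⁺ _ (allFin N) λ {j} _ → no-edge-at i j
    where
      no-edge-at : ∀ i j → not (lookup S i ∧ lookup S j ∧ adj G i j) ≡ true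
      no-edge-at i j with lookup S i in i∈S | lookup S j in j∈S
      ... | false | _     = refl
      ... | true  | false = refl
      ... | true  | true  rewrite no-edge i∈S j∈S = refl

  Δ-independent : ∀ S → independent G S ≡ true → Δ[ G ] S ≡ 0
  Δ-independent S indep = n≤0⇒n≡0 (Δ-lub S λ {v} v∈S →
    ≤-reflexive (trans (degIn≡count S v) (count-false (no-neighbour v∈S))))
    where
      no-neighbour : ∀ {v} → lookup S v ≡ true → ∀ u → (lookup S u ∧ adj G v u) ≡ false
      no-neighbour {v} v∈S u with lookup S u in u∈S
      ... | false = refl
      ... | true  = independent⁻ S indep v∈S u∈S

  ∣independent∣≤α : ∀ S → independent G S ≡ true → ∣ S ∣ ≤ α G
  ∣independent∣≤α S = ≤-maxℕ-map-filter (λ S → independent G S ≟ᵇ true) ∣_∣ (∈-allSubsets S)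

  α-lub : ∀ {k} → (∀ S → independent G S ≡ true → ∣ S ∣ ≤ k) → α G ≤ k
  α-lub h = maxℕ-map-filter-≤ (λ S → independent G S ≟ᵇ true) {allSubsets N} ∣_∣ (λ {S} → h S)

  α-attained : ∃[ S ] independent G S ≡ true × ∣ S ∣ ≡ α G
  α-attained with maxℕ-map-filter-attained (λ S → independent G S ≟ᵇ true) {allSubsets N} ∣_∣
  ... | inj₂ attained = attained
  ... | inj₁ α≡0      = ⊥ , independent⁺ ⊥ (λ {i} i∈⊥ _ → ∈⊥-elim {i = i} i∈⊥) , trans (∣⊥∣≡0 N) (sym α≡0)

  α≤V : α G ≤ N
  α≤V = let S , _ , ∣S∣≡α = α-attained in subst (_≤ N) ∣S∣≡α (∣p∣≤n S)

  independent-ofSize : ∀ {j} → j ≤ α G → ∃[ B ] ∣ B ∣ ≡ j × Δ[ G ] B ≡ 0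
  independent-ofSize {j} j≤α =
    let S , indep , ∣S∣≡α = α-attained
        B , B⊆S , ∣B∣≡j    = ⊆-ofSize S j (subst (j ≤_) (sym ∣S∣≡α) j≤α)
    in B , ∣B∣≡j , n≤0⇒n≡0 (subst (Δ[ G ] B ≤_) (Δ-independent S indep) (Δ-mono B S B⊆S))

  σ≤∞Δ : ∀ S → α G < ∣ S ∣ → σ G ≤∞ fin (Δ[ G ] S)
  σ≤∞Δ S = min∞-map-filter-≤∞ (λ S → α G <? ∣ S ∣) (λ S → fin (Δ[ G ] S)) (∈-allSubsets S)

  σ-attained : σ G ≡ ∞ ⊎ ∃[ S ] α G < ∣ S ∣ × fin (Δ[ G ] S) ≡ σ G
  σ-attained = min∞-map-filter-attained (λ S → α G <? ∣ S ∣) {allSubsets N} (λ S → fin (Δ[ G ] S))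

  σ-glb : ∀ {z} → (∀ S → α G < ∣ S ∣ → z ≤∞ fin (Δ[ G ] S)) → z ≤∞ σ G
  σ-glb h = ≤∞-min∞-map-filter (λ S → α G <? ∣ S ∣) {allSubsets N} (λ S → fin (Δ[ G ] S)) (λ {S} → h S)

  σₖ≤∞Δ : ∀ k S → ∣ S ∣ ≡ α G + suc k → σₖ G (suc k) ≤∞ fin (Δ[ G ] S)
  σₖ≤∞Δ k S = min∞-map-filter-≤∞ (λ S → ∣ S ∣ ≟ℕ (α G + suc k)) (λ S → fin (Δ[ G ] S)) (∈-allSubsets S)

  σₖ-attained : ∀ k → σₖ G (suc k) ≡ ∞ ⊎ ∃[ S ] ∣ S ∣ ≡ α G + suc k × fin (Δ[ G ] S) ≡ σₖ G (suc k)
  σₖ-attained k = min∞-map-filter-attained (λ S → ∣ S ∣ ≟ℕ (α G + suc k)) {allSubsets N} (λ S → fin (Δ[ G ] S))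

  -- Below α the truncated index j ∸ α G is 0, and σ₀ = 0 is realised by an independent set.
  σₖ-shift-attained : ∀ j → σₖ G (j ∸ α G) ≡ ∞ ⊎ ∃[ B ] ∣ B ∣ ≡ j × fin (Δ[ G ] B) ≤∞ σₖ G (j ∸ α G)
  σₖ-shift-attained j with j ∸ α G in j∸α≡
  ... | zero  = let B , ∣B∣≡j , Δ≡0 = independent-ofSize (m∸n≡0⇒m≤n j∸α≡)
                in inj₂ (B , ∣B∣≡j , fin≤fin (≤-reflexive Δ≡0))
  ... | suc k with σₖ-attained k
  ...   | inj₁ σₖ≡∞ = inj₁ σₖ≡∞
  ...   | inj₂ (B , ∣B∣≡α+1+k , Δ≡σₖ) =
    inj₂ (B , trans ∣B∣≡α+1+k (sym (m∸n≡1+k⇒m≡n+1+k j∸α≡)) , ≤∞-reflexive Δ≡σₖ)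

  σₖ-shift-≤∞Δ : ∀ {m} B → m ≤ ∣ B ∣ → σₖ G (m ∸ α G) ≤∞ fin (Δ[ G ] B)
  σₖ-shift-≤∞Δ {m} B m≤∣B∣ =
    let T , T⊆B , ∣T∣≡m = ⊆-ofSize B m m≤∣B∣
    in ≤∞-trans (subst (λ t → σₖ G (t ∸ α G) ≤∞ fin (Δ[ G ] T)) ∣T∣≡m (exact T)) (fin≤fin (Δ-mono T B T⊆B))
    where
      exact : ∀ T → σₖ G (∣ T ∣ ∸ α G) ≤∞ fin (Δ[ G ] T)
      exact T with ∣ T ∣ ∸ α G in ∣T∣∸α≡
      ... | zero  = fin≤fin z≤n
      ... | suc k = σₖ≤∞Δ k T (m∸n≡1+k⇒m≡n+1+k ∣T∣∸α≡)

-- The n-cone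

module Cone (n : ℕ) (G : Graph) where

  open Invariants

  private
    N = V G
    H = cone n G
    a = α G

  adj-↑ˡ-↑ˡ : ∀ i i′ → adj H (i ↑ˡ N) (i′ ↑ˡ N) ≡ false
  adj-↑ˡ-↑ˡ i i′ rewrite splitAt-↑ˡ n i N | splitAt-↑ˡ n i′ N = refl

  adj-↑ˡ-↑ʳ : ∀ i j → adj H (i ↑ˡ N) (n ↑ʳ j) ≡ true
  adj-↑ˡ-↑ʳ i j rewrite splitAt-↑ˡ n i N | splitAt-↑ʳ n N j = refl

  adj-↑ʳ-↑ˡ : ∀ j i → adj H (n ↑ʳ j) (i ↑ˡ N) ≡ true
  adj-↑ʳ-↑ˡ j i rewrite splitAt-↑ˡ n i N | splitAt-↑ʳ n N j = refl

  adj-↑ʳ-↑ʳ : ∀ j j′ → adj H (n ↑ʳ j) (n ↑ʳ j′) ≡ adj G j j′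
  adj-↑ʳ-↑ʳ j j′ rewrite splitAt-↑ʳ n N j | splitAt-↑ʳ n N j′ = refl

  module _ (A : Subset n) (B : Subset N) where

    private
      S = A ++ B

    degIn-↑ˡ : ∀ i → degIn H S (i ↑ˡ N) ≡ ∣ B ∣
    degIn-↑ˡ i = begin
      degIn H S (i ↑ˡ N)                                    ≡⟨ degIn≡count H S (i ↑ˡ N) ⟩
      count (λ u → lookup S u ∧ adj H (i ↑ˡ N) u)           ≡⟨ count-++ n _ ⟩
      count (λ i′ → lookup S (i′ ↑ˡ N) ∧ adj H (i ↑ˡ N) (i′ ↑ˡ N))
        + count (λ j → lookup S (n ↑ʳ j) ∧ adj H (i ↑ˡ N) (n ↑ʳ j))
        ≡⟨ cong₂ _+_ (count-false λ i′ → trans (cong (_ ∧_) (adj-↑ˡ-↑ˡ i i′)) (∧-zeroʳ _))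
                     (count-cong λ j → trans (cong₂ _∧_ (lookup-++ʳ A B j) (adj-↑ˡ-↑ʳ i j)) (∧-identityʳ _)) ⟩
      count (lookup B)                                      ≡⟨ ∣∣≡count B ⟨
      ∣ B ∣                                                 ∎
      where open ≡-Reasoning

    degIn-↑ʳ : ∀ j → degIn H S (n ↑ʳ j) ≡ ∣ A ∣ + degIn G B j
    degIn-↑ʳ j = begin
      degIn H S (n ↑ʳ j)                                    ≡⟨ degIn≡count H S (n ↑ʳ j) ⟩
      count (λ u → lookup S u ∧ adj H (n ↑ʳ j) u)           ≡⟨ count-++ n _ ⟩
      count (λ i → lookup S (i ↑ˡ N) ∧ adj H (n ↑ʳ j) (i ↑ˡ N))
        + count (λ j′ → lookup S (n ↑ʳ j′) ∧ adj H (n ↑ʳ j) (n ↑ʳ j′))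
        ≡⟨ cong₂ _+_ (count-cong λ i → trans (cong₂ _∧_ (lookup-++ˡ A B i) (adj-↑ʳ-↑ˡ j i)) (∧-identityʳ _))
                     (count-cong λ j′ → cong₂ _∧_ (lookup-++ʳ A B j′) (adj-↑ʳ-↑ʳ j j′)) ⟩
      count (lookup A) + count (λ j′ → lookup B j′ ∧ adj G j j′)
        ≡⟨ cong₂ _+_ (∣∣≡count A) (degIn≡count G B j) ⟨
      ∣ A ∣ + degIn G B j                                   ∎
      where open ≡-Reasoning

    Δ-cone-≤ : Δ[ H ] S ≤ ∣ B ∣ ⊔ (∣ A ∣ + Δ[ G ] B)
    Δ-cone-≤ = Δ-lub H S λ {v} v∈S → bound v v∈S
      where
        bound : ∀ v → lookup S v ≡ true → degIn H S v ≤ ∣ B ∣ ⊔ (∣ A ∣ + Δ[ G ] B)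
        bound v v∈S with ↑ˡ-or-↑ʳ n v
        ... | inj₁ (i , refl) = subst (_≤ _) (sym (degIn-↑ˡ i)) (m≤m⊔n _ _)
        ... | inj₂ (j , refl) = subst (_≤ _) (sym (degIn-↑ʳ j))
              (m≤n⇒m≤o⊔n ∣ B ∣ (+-monoʳ-≤ ∣ A ∣ (degIn≤Δ G B (trans (sym (lookup-++ʳ A B j)) v∈S))))

    ∣B∣≤Δ-cone : 1 ≤ ∣ A ∣ → ∣ B ∣ ≤ Δ[ H ] S
    ∣B∣≤Δ-cone 1≤∣A∣ =
      let i , i∈A = ∣∣-witness A 1≤∣A∣
      in subst (_≤ _) (degIn-↑ˡ i) (degIn≤Δ H S (trans (lookup-++ˡ A B i) i∈A))

    +Δ≤Δ-cone : 1 ≤ ∣ B ∣ → ∣ A ∣ + Δ[ G ] B ≤ Δ[ H ] S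
    +Δ≤Δ-cone 1≤∣B∣ =
      let j₀ , j₀∈B      = ∣∣-witness B 1≤∣B∣
          j , j∈B , degΔ = Δ-attained G B j₀∈B
      in subst (_≤ _) (trans (degIn-↑ʳ j) (cong (∣ A ∣ +_) degΔ)) (degIn≤Δ H S (trans (lookup-++ʳ A B j) j∈B))

    Δ≤Δ-cone : 1 ≤ ∣ B ∣ → Δ[ G ] B ≤ Δ[ H ] S
    Δ≤Δ-cone 1≤∣B∣ = ≤-trans (m≤n+m _ ∣ A ∣) (+Δ≤Δ-cone 1≤∣B∣)

  Δ-cone-⊥ : ∀ B → Δ[ H ] (⊥ {n} ++ B) ≤ Δ[ G ] B
  Δ-cone-⊥ B = Δ-lub H (⊥ {n} ++ B) λ {v} v∈S → bound v v∈S
    where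
      bound : ∀ v → lookup (⊥ {n} ++ B) v ≡ true → degIn H (⊥ {n} ++ B) v ≤ Δ[ G ] B
      bound v v∈S with ↑ˡ-or-↑ʳ n v
      ... | inj₁ (i , refl) = ∈⊥-elim {i = i} (trans (sym (lookup-++ˡ (⊥ {n}) B i)) v∈S)
      ... | inj₂ (j , refl) = subst (_≤ _) (sym (trans (degIn-↑ʳ (⊥ {n}) B j) (cong (_+ _) (∣⊥∣≡0 n))))
            (degIn≤Δ G B (trans (sym (lookup-++ʳ (⊥ {n}) B j)) v∈S))

  independent-cone⁺ : ∀ A B → (∀ {i j} → lookup A i ≡ true → lookup B j ≡ false) →
                      independent G B ≡ true → independent H (A ++ B) ≡ true
  independent-cone⁺ A B disjoint indep = independent⁺ H (A ++ B) no-edge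
    where
      no-edge : ∀ {u w} → lookup (A ++ B) u ≡ true → lookup (A ++ B) w ≡ true → adj H u w ≡ false
      no-edge {u} {w} u∈S w∈S with ↑ˡ-or-↑ʳ n u | ↑ˡ-or-↑ʳ n w
      ... | inj₁ (i , refl) | inj₁ (i′ , refl) = adj-↑ˡ-↑ˡ i i′
      ... | inj₁ (i , refl) | inj₂ (j , refl) with trans (sym (disjoint (trans (sym (lookup-++ˡ A B i)) u∈S)))
                                                         (trans (sym (lookup-++ʳ A B j)) w∈S)
      ...   | ()
      no-edge u∈S w∈S | inj₂ (j , refl) | inj₁ (i , refl) with trans (sym (disjoint (trans (sym (lookup-++ˡ A B i)) w∈S)))
                                                                    (trans (sym (lookup-++ʳ A B j)) u∈S)
      ...   | ()
      no-edge u∈S w∈S | inj₂ (j , refl) | inj₂ (j′ , refl) =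
        trans (adj-↑ʳ-↑ʳ j j′) (independent⁻ G B indep (trans (sym (lookup-++ʳ A B j)) u∈S) (trans (sym (lookup-++ʳ A B j′)) w∈S))

  ∣independent-cone∣≤ : ∀ A B → independent H (A ++ B) ≡ true → ∣ A ∣ + ∣ B ∣ ≤ n ⊔ a
  ∣independent-cone∣≤ A B indep with ∣ A ∣ ≟ℕ 0 | ∣ B ∣ ≟ℕ 0
  ... | yes ∣A∣≡0 | _ = begin
    ∣ A ∣ + ∣ B ∣ ≡⟨ cong (_+ ∣ B ∣) ∣A∣≡0 ⟩
    ∣ B ∣         ≤⟨ ∣independent∣≤α G B indepB ⟩
    a             ≤⟨ m≤n⊔m n a ⟩
    n ⊔ a         ∎
    where
      open ≤-Reasoning
      indepB : independent G B ≡ true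
      indepB = independent⁺ G B λ {j} {j′} j∈B j′∈B → trans (sym (adj-↑ʳ-↑ʳ j j′))
        (independent⁻ H (A ++ B) indep (trans (lookup-++ʳ A B j) j∈B) (trans (lookup-++ʳ A B j′) j′∈B))
  ... | no _ | yes ∣B∣≡0 = begin
    ∣ A ∣ + ∣ B ∣ ≡⟨ trans (cong (∣ A ∣ +_) ∣B∣≡0) (+-identityʳ _) ⟩
    ∣ A ∣         ≤⟨ ∣p∣≤n A ⟩
    n             ≤⟨ m≤m⊔n n a ⟩
    n ⊔ a         ∎
    where open ≤-Reasoning
  ... | no ∣A∣≢0 | no ∣B∣≢0 with ∣∣-witness A (n≢0⇒n>0 ∣A∣≢0) | ∣∣-witness B (n≢0⇒n>0 ∣B∣≢0)
  ...   | i , i∈A | j , j∈B with trans (sym (adj-↑ˡ-↑ʳ i j))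
                                 (independent⁻ H (A ++ B) indep (trans (lookup-++ˡ A B i) i∈A) (trans (lookup-++ʳ A B j) j∈B))
  ...     | ()

  α-cone : α H ≡ n ⊔ a
  α-cone = ≤-antisym
    (α-lub H λ S indep → let A , B , S≡A++B = Vec.splitAt n S in
      subst (λ S → ∣ S ∣ ≤ n ⊔ a) (sym S≡A++B)
        (subst (_≤ n ⊔ a) (sym (∣++∣ A B)) (∣independent-cone∣≤ A B (subst (λ S → independent H S ≡ true) S≡A++B indep))))
    (⊔-lub n≤α a≤α)
    where
      n≤α : n ≤ α H
      n≤α = subst (_≤ α H) (trans (∣++∣ (⊤ {n}) (⊥ {N})) (trans (cong₂ _+_ (∣⊤∣≡n n) (∣⊥∣≡0 N)) (+-identityʳ n)))
              (∣independent∣≤α H (⊤ {n} ++ ⊥ {N}) (independent-cone⁺ ⊤ (⊥ {N}) (λ {_} {j} _ → ∉⊥ j)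
                (independent⁺ G ⊥ λ {i} i∈⊥ _ → ∈⊥-elim {i = i} i∈⊥)))
      a≤α : a ≤ α H
      a≤α = let S , indep , ∣S∣≡a = α-attained G in
        subst (_≤ α H) (trans (∣++∣ (⊥ {n}) S) (cong₂ _+_ (∣⊥∣≡0 n) ∣S∣≡a))
          (∣independent∣≤α H (⊥ {n} ++ S) (independent-cone⁺ (⊥ {n}) S (λ {i} i∈⊥ → ∈⊥-elim {i = i} i∈⊥) indep))

  σ-cone-≤∞Δ : ∀ (A : Subset n) (B : Subset N) → n ⊔ a < ∣ A ∣ + ∣ B ∣ → σ H ≤∞ fin (Δ[ H ] (A ++ B))
  σ-cone-≤∞Δ A B large = σ≤∞Δ H (A ++ B) (subst₂ _<_ (sym α-cone) (sym (∣++∣ A B)) large)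

  σ-cone-glb : ∀ {z} → (∀ (A : Subset n) (B : Subset N) → n ⊔ a < ∣ A ∣ + ∣ B ∣ → z ≤∞ fin (Δ[ H ] (A ++ B))) → z ≤∞ σ H
  σ-cone-glb h = σ-glb H λ S large → let A , B , S≡A++B = Vec.splitAt n S in
    subst (λ S → _ ≤∞ fin (Δ[ H ] S)) (sym S≡A++B)
      (h A B (subst₂ _<_ α-cone (trans (cong ∣_∣ S≡A++B) (∣++∣ A B)) large))

  σ-cone-≤∞-⊔ : ∀ (A : Subset n) (B : Subset N) → n ⊔ a < ∣ A ∣ + ∣ B ∣ → σ H ≤∞ fin (∣ B ∣ ⊔ (∣ A ∣ + Δ[ G ] B))
  σ-cone-≤∞-⊔ A B large = ≤∞-trans (σ-cone-≤∞Δ A B large) (fin≤fin (Δ-cone-≤ A B))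

  σ-cone-≤∞ΔG : ∀ (B : Subset N) → n ⊔ a < ∣ B ∣ → σ H ≤∞ fin (Δ[ G ] B)
  σ-cone-≤∞ΔG B large = ≤∞-trans
    (σ-cone-≤∞Δ (⊥ {n}) B (subst (λ k → n ⊔ a < k + ∣ B ∣) (sym (∣⊥∣≡0 n)) large))
    (fin≤fin (Δ-cone-⊥ B))

  σ-cone-≤∞c : a ≤ n → ∀ {j} → 1 ≤ j → j ≤ n + 1 → σ H ≤∞ c n G j
  σ-cone-≤∞c a≤n {j} 1≤j j≤n+1 with σₖ-shift-attained G j
  ... | inj₁ σₖ≡∞ rewrite σₖ≡∞ = x≤∞∞
  ... | inj₂ (B , ∣B∣≡j , Δ≤σₖ) =
    let A , ∣A∣≡n+1-j = subset-ofSize {n} (n + 1 ∸ j) n+1-j≤n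
    in ≤∞-trans (σ-cone-≤∞-⊔ A B (large A ∣A∣≡n+1-j))
       (≤∞-trans (fin≤fin (≤-reflexive (cong₂ (λ x y → x ⊔ (y + Δ[ G ] B)) ∣B∣≡j ∣A∣≡n+1-j)))
                 (⊔∞-+∞-monoʳ j (n + 1 ∸ j) Δ≤σₖ))
    where
      n+1-j≤n : n + 1 ∸ j ≤ n
      n+1-j≤n = ≤-trans (∸-monoʳ-≤ (n + 1) 1≤j) (≤-reflexive (m+n∸n≡m n 1))
      large : ∀ (A : Subset n) → ∣ A ∣ ≡ n + 1 ∸ j → n ⊔ a < ∣ A ∣ + ∣ B ∣
      large A ∣A∣≡ = subst₂ _<_ (sym (m≥n⇒m⊔n≡m a≤n))
        (sym (trans (cong₂ _+_ ∣A∣≡ ∣B∣≡j) (m∸n+n≡m j≤n+1))) (≤-reflexive (+-comm 1 n))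

  σ-cone-≤∞min1to-c : a ≤ n → ∀ {m} → m ≤ n → σ H ≤∞ min1to m (c n G)
  σ-cone-≤∞min1to-c a≤n {m} m≤n =
    ≤∞-min1to m (c n G) λ 1≤j j≤m → σ-cone-≤∞c a≤n 1≤j (≤-trans j≤m (≤-trans m≤n (m≤m+n n 1)))

  σ-cone-≤∞σₖ : a ≤ n → σ H ≤∞ σₖ G (n + 1 ∸ a)
  σ-cone-≤∞σₖ a≤n with σₖ-shift-attained G (n + 1)
  ... | inj₁ σₖ≡∞ rewrite σₖ≡∞ = x≤∞∞
  ... | inj₂ (B , ∣B∣≡n+1 , Δ≤σₖ) = ≤∞-trans (σ-cone-≤∞ΔG B large) Δ≤σₖ
    where
      large : n ⊔ a < ∣ B ∣
      large = subst₂ _<_ (sym (m≥n⇒m⊔n≡m a≤n)) (sym ∣B∣≡n+1) (≤-reflexive (+-comm 1 n))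

  σ-cone-≤∞σ : n ≤ a → σ H ≤∞ σ G
  σ-cone-≤∞σ n≤a with σ-attained G
  ... | inj₁ σ≡∞ rewrite σ≡∞ = x≤∞∞
  ... | inj₂ (B , a<∣B∣ , Δ≡σ) =
    ≤∞-trans (σ-cone-≤∞ΔG B (subst (_< ∣ B ∣) (sym (m≤n⇒m⊔n≡n n≤a)) a<∣B∣)) (≤∞-reflexive Δ≡σ)

  -- A of size j together with an independent B of size a + 1 - j.
  σ-cone-≤∞-⊔∸ : n ≤ a → ∀ {j} → 1 ≤ j → j ≤ n → σ H ≤∞ fin j ⊔∞ fin (a + 1 ∸ j)
  σ-cone-≤∞-⊔∸ n≤a {j} 1≤j j≤n =
    let A , ∣A∣≡j         = subset-ofSize {n} j j≤n
        B , ∣B∣≡a+1-j , Δ≡0 = independent-ofSize G a+1-j≤a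
    in ≤∞-trans (σ-cone-≤∞-⊔ A B (large A B ∣A∣≡j ∣B∣≡a+1-j))
         (fin≤fin (≤-reflexive (begin
           ∣ B ∣ ⊔ (∣ A ∣ + Δ[ G ] B) ≡⟨ cong₂ _⊔_ ∣B∣≡a+1-j (cong₂ _+_ ∣A∣≡j Δ≡0) ⟩
           (a + 1 ∸ j) ⊔ (j + 0)      ≡⟨ cong ((a + 1 ∸ j) ⊔_) (+-identityʳ j) ⟩
           (a + 1 ∸ j) ⊔ j            ≡⟨ ⊔-comm (a + 1 ∸ j) j ⟩
           j ⊔ (a + 1 ∸ j)            ∎)))
    where
      open ≡-Reasoning
      a+1-j≤a : a + 1 ∸ j ≤ a
      a+1-j≤a = ≤-trans (∸-monoʳ-≤ (a + 1) 1≤j) (≤-reflexive (m+n∸n≡m a 1))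
      large : ∀ (A : Subset n) (B : Subset N) → ∣ A ∣ ≡ j → ∣ B ∣ ≡ a + 1 ∸ j → n ⊔ a < ∣ A ∣ + ∣ B ∣
      large A B ∣A∣≡ ∣B∣≡ = subst₂ _<_ (sym (m≤n⇒m⊔n≡n n≤a))
        (sym (trans (cong₂ _+_ ∣A∣≡ ∣B∣≡) (m+[n∸m]≡n (≤-trans j≤n (≤-trans n≤a (m≤m+n a 1))))))
        (≤-reflexive (+-comm 1 a))

  min1to-c≤∞Δ-cone : ∀ {m} (A : Subset n) (B : Subset N) → m ≤ n → ∣ B ∣ ≤ m → n < ∣ A ∣ + ∣ B ∣ → min1to m (c n G) ≤∞ fin (Δ[ H ] (A ++ B))
  min1to-c≤∞Δ-cone A B m≤n ∣B∣≤m n<∣A∣+∣B∣ = ≤∞-trans (min1to-≤∞ (c n G) 1≤∣B∣ ∣B∣≤m) (≤∞-trans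
    (⊔∞-+∞-monoʳ ∣ B ∣ (n + 1 ∸ ∣ B ∣) (σₖ-shift-≤∞Δ G B ≤-refl))
    (fin≤fin (⊔-lub (∣B∣≤Δ-cone A B 1≤∣A∣)
                    (≤-trans (+-monoˡ-≤ (Δ[ G ] B) n+1-∣B∣≤∣A∣) (+Δ≤Δ-cone A B 1≤∣B∣)))))
    where
      1≤∣A∣ = m<k+l∧l≤m⇒0<k ∣ A ∣ ∣ B ∣ n<∣A∣+∣B∣ (≤-trans ∣B∣≤m m≤n)
      1≤∣B∣ = m<k+l∧k≤m⇒0<l ∣ A ∣ ∣ B ∣ n<∣A∣+∣B∣ (∣p∣≤n A)
      n+1-∣B∣≤∣A∣ : n + 1 ∸ ∣ B ∣ ≤ ∣ A ∣
      n+1-∣B∣≤∣A∣ = m≤n+o⇒m∸n≤o (n + 1) ∣ B ∣ (subst₂ _≤_ (+-comm 1 n) (+-comm ∣ A ∣ ∣ B ∣) n<∣A∣+∣B∣)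

  σ-cone-of-V≤n : N ≤ n → σ H ≡ min1to N (c n G)
  σ-cone-of-V≤n N≤n = ≤∞-antisym
    (σ-cone-≤∞min1to-c (≤-trans (α≤V G) N≤n) N≤n)
    (σ-cone-glb λ A B large → min1to-c≤∞Δ-cone A B N≤n (∣p∣≤n B) (m⊔n<o⇒m<o n a large))

  σ-cone-of-α<n : a < n → σ H ≡ min1to n (c n G) ⊓∞ σₖ G (n + 1 ∸ a)
  σ-cone-of-α<n a<n = ≤∞-antisym
    (⊓∞-glb (σ-cone-≤∞min1to-c (<⇒≤ a<n) ≤-refl) (σ-cone-≤∞σₖ (<⇒≤ a<n)))
    (σ-cone-glb bound)
    where
      bound : ∀ (A : Subset n) (B : Subset N) → n ⊔ a < ∣ A ∣ + ∣ B ∣ →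
              min1to n (c n G) ⊓∞ σₖ G (n + 1 ∸ a) ≤∞ fin (Δ[ H ] (A ++ B))
      bound A B large with ∣ B ∣ ≤? n
      ... | yes ∣B∣≤n = ≤∞-trans (x⊓∞y≤∞x _ _)
            (min1to-c≤∞Δ-cone A B ≤-refl ∣B∣≤n (m⊔n<o⇒m<o n a large))
      ... | no ∣B∣≰n = ≤∞-trans (x⊓∞y≤∞y _ _)
            (≤∞-trans (σₖ-shift-≤∞Δ G B (subst (_≤ ∣ B ∣) (+-comm 1 n) (≰⇒> ∣B∣≰n)))
                      (fin≤fin (Δ≤Δ-cone A B (m<n⇒0<n (≰⇒> ∣B∣≰n)))))

  σ-cone-of-n≤α : n ≤ a → σ H ≡ min1to n (λ j → fin j ⊔∞ fin (a + 1 ∸ j)) ⊓∞ σ G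
  σ-cone-of-n≤α n≤a = ≤∞-antisym
    (⊓∞-glb (≤∞-min1to n _ (σ-cone-≤∞-⊔∸ n≤a)) (σ-cone-≤∞σ n≤a))
    (σ-cone-glb bound)
    where
      bound : ∀ (A : Subset n) (B : Subset N) → n ⊔ a < ∣ A ∣ + ∣ B ∣ →
              min1to n (λ j → fin j ⊔∞ fin (a + 1 ∸ j)) ⊓∞ σ G ≤∞ fin (Δ[ H ] (A ++ B))
      bound A B large with ∣ A ∣ ≟ℕ 0
      ... | yes ∣A∣≡0 = ≤∞-trans (x⊓∞y≤∞y _ _)
            (≤∞-trans (σ≤∞Δ G B a<∣B∣) (fin≤fin (Δ≤Δ-cone A B (m<n⇒0<n a<∣B∣))))
        where
          a<∣B∣ : a < ∣ B ∣
          a<∣B∣ = m⊔n<o⇒n<o n a (subst (λ k → n ⊔ a < k + ∣ B ∣) ∣A∣≡0 large)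
      ... | no ∣A∣≢0 = ≤∞-trans (x⊓∞y≤∞x _ _) (≤∞-trans (min1to-≤∞ _ 1≤∣A∣ (∣p∣≤n A))
            (fin≤fin (⊔-lub (≤-trans (m≤m+n ∣ A ∣ _) (+Δ≤Δ-cone A B 1≤∣B∣))
                            (≤-trans a+1-∣A∣≤∣B∣ (∣B∣≤Δ-cone A B 1≤∣A∣)))))
        where
          a<∣A∣+∣B∣ = m⊔n<o⇒n<o n a large
          1≤∣A∣ = n≢0⇒n>0 ∣A∣≢0
          1≤∣B∣ = m<k+l∧k≤m⇒0<l ∣ A ∣ ∣ B ∣ a<∣A∣+∣B∣ (≤-trans (∣p∣≤n A) n≤a)
          a+1-∣A∣≤∣B∣ : a + 1 ∸ ∣ A ∣ ≤ ∣ B ∣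
          a+1-∣A∣≤∣B∣ = m≤n+o⇒m∸n≤o (a + 1) ∣ A ∣ (subst (_≤ ∣ A ∣ + ∣ B ∣) (+-comm 1 a) a<∣A∣+∣B∣)

-- min over 1 ≤ j ≤ m of max(j, p - j)

⌈n/2⌉≤1+⌊n/2⌋ : ∀ n → ⌈ n /2⌉ ≤ suc ⌊ n /2⌋
⌈n/2⌉≤1+⌊n/2⌋ zero          = z≤n
⌈n/2⌉≤1+⌊n/2⌋ (suc zero)    = ≤-refl
⌈n/2⌉≤1+⌊n/2⌋ (suc (suc n)) = s≤s (⌈n/2⌉≤1+⌊n/2⌋ n)

min1to-⊔∸-below-half : ∀ p {m} → 1 ≤ m → m ≤ ⌊ p /2⌋ → min1to m (λ j → fin j ⊔∞ fin (p ∸ j)) ≡ fin (p ∸ m)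
min1to-⊔∸-below-half p {m} 1≤m m≤⌊p/2⌋ = ≤∞-antisym
  (≤∞-trans (min1to-≤∞ _ 1≤m ≤-refl) (fin≤fin (≤-reflexive (m≤n⇒m⊔n≡n m≤p∸m))))
  (≤∞-min1to m _ λ {j} _ j≤m → fin≤fin (≤-trans (∸-monoʳ-≤ p j≤m) (m≤n⊔m j (p ∸ j))))
  where
    m≤p∸m : m ≤ p ∸ m
    m≤p∸m = m+n≤o⇒m≤o∸n m (begin
      m + m               ≤⟨ +-mono-≤ m≤⌊p/2⌋ (≤-trans m≤⌊p/2⌋ (⌊n/2⌋≤⌈n/2⌉ p)) ⟩
      ⌊ p /2⌋ + ⌈ p /2⌉   ≡⟨ ⌊n/2⌋+⌈n/2⌉≡n p ⟩
      p                   ∎)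
      where open ≤-Reasoning

min1to-⊔∸-above-half : ∀ p {m} → 1 ≤ p → ⌊ p /2⌋ < m → min1to m (λ j → fin j ⊔∞ fin (p ∸ j)) ≡ fin ⌈ p /2⌉
min1to-⊔∸-above-half p {m} 1≤p ⌊p/2⌋<m = ≤∞-antisym
  (≤∞-trans (min1to-≤∞ _ (⌈n/2⌉-mono 1≤p) (≤-trans (⌈n/2⌉≤1+⌊n/2⌋ p) ⌊p/2⌋<m))
            (fin≤fin (≤-reflexive (trans (cong (⌈ p /2⌉ ⊔_) p∸⌈p/2⌉≡⌊p/2⌋) (m≥n⇒m⊔n≡m (⌊n/2⌋≤⌈n/2⌉ p))))))
  (≤∞-min1to m _ λ {j} _ _ → fin≤fin (⌈p/2⌉≤ j))
  where
    p∸⌈p/2⌉≡⌊p/2⌋ : p ∸ ⌈ p /2⌉ ≡ ⌊ p /2⌋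
    p∸⌈p/2⌉≡⌊p/2⌋ = trans (cong (_∸ ⌈ p /2⌉) (sym (⌊n/2⌋+⌈n/2⌉≡n p))) (m+n∸n≡m ⌊ p /2⌋ ⌈ p /2⌉)
    p∸⌊p/2⌋≡⌈p/2⌉ : p ∸ ⌊ p /2⌋ ≡ ⌈ p /2⌉
    p∸⌊p/2⌋≡⌈p/2⌉ = trans (cong (_∸ ⌊ p /2⌋) (sym (⌊n/2⌋+⌈n/2⌉≡n p))) (m+n∸m≡n ⌊ p /2⌋ ⌈ p /2⌉)
    ⌈p/2⌉≤ : ∀ j → ⌈ p /2⌉ ≤ j ⊔ (p ∸ j)
    ⌈p/2⌉≤ j with j ≤? ⌊ p /2⌋
    ... | yes j≤⌊p/2⌋ = ≤-trans (≤-trans (≤-reflexive (sym p∸⌊p/2⌋≡⌈p/2⌉)) (∸-monoʳ-≤ p j≤⌊p/2⌋)) (m≤n⊔m j (p ∸ j))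
    ... | no j≰⌊p/2⌋  = ≤-trans (≤-trans (⌈n/2⌉≤1+⌊n/2⌋ p) (≰⇒> j≰⌊p/2⌋)) (m≤m⊔n j (p ∸ j))

theorem3p7 : (G : Graph) (n : ℕ) → 2 ≤ n →
    (V G ≤ n → σ (cone n G) ≡ min1to (V G) (c n G))
  × (α G < n → n < V G →
       σ (cone n G) ≡ min1to n (c n G) ⊓∞ σₖ G (n + 1 ∸ α G))
  × (n ≤ α G →
       (σ (cone n G) ≡ min1to n (λ j → fin j ⊔∞ fin (α G + 1 ∸ j)) ⊓∞ σ G)
     × (n > ⌊ α G + 1 /2⌋ → σ (cone n G) ≡ σ G ⊓∞ fin ⌈ α G + 1 /2⌉)
     × (n ≤ ⌊ α G + 1 /2⌋ → σ (cone n G) ≡ σ G ⊓∞ fin (α G + 1 ∸ n)))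
theorem3p7 G n 2≤n =
    σ-cone-of-V≤n
  , (λ α<n _ → σ-cone-of-α<n α<n)
  , λ n≤α →
      let σ-cone = σ-cone-of-n≤α n≤α in
        σ-cone
      , (λ ⌊α+1/2⌋<n → trans σ-cone (trans (cong (_⊓∞ σ G) (min1to-⊔∸-above-half (α G + 1) (m≤n+m 1 (α G)) ⌊α+1/2⌋<n))
                                           (⊓∞-comm _ (σ G))))
      , (λ n≤⌊α+1/2⌋ → trans σ-cone (trans (cong (_⊓∞ σ G) (min1to-⊔∸-below-half (α G + 1) (≤-trans (s≤s z≤n) 2≤n) n≤⌊α+1/2⌋))
                                           (⊓∞-comm _ (σ G))))
  where open Cone n G
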